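{- Let $(M,\mathcal{C},\mathcal{C}^*)$ be an orthogonally oriented matroid. If $\tilde{\mathcal{C}}^*$ is another cocircuit signature of $M$ such that every element of $\mathcal{C}$ is orthogonal to every element of $\tilde{\mathcal{C}}^*$, then $\tilde{\mathcal{C}}^*=\mathcal{C}^*$.
   Context: Matroids are in the sense of Bruhn, Diestel, Kriesell, Pendavingh and Wollan (possibly infinite ground set); cocircuits are circuits of the dual $M^*$. A signed subset $X$ of $E$ is a support $\underline{X}\subseteq E$ with a partition $(X^+,X^-)$; $X(e)=\pm1$ according as $e\in X^\pm$; $-X$ swaps the parts. $X,Y$ are orthogonal if $\underline{X}\cap\underline{Y}=\emptyset$ or there are $e,f\in\underline{X}\cap\underline{Y}$ with $X(e)Y(e)=-X(f)Y(f)$. A circuit signature of $M$ is a set of signed subsets consisting of exactly two opposite signed subsets supported by each circuit of $M$; a cocircuit signature is a circuit signature of $M^*$. $(M,\mathcal{C},\mathcal{C}^*)$ is an orthogonally oriented matroid if $\mathcal{C}$ is a circuit signature, $\mathcal{C}^*$ a cocircuit signature of $M$, and every element of $\mathcal{C}$ is orthogonal to every element of $\mathcal{C}^*$. -}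

module Defs where

open import Level using (0ℓ; _⊔_) renaming (suc to lsuc)
open import Data.Empty using (⊥)
open import Data.Product using (Σ; ∃; ∃-syntax; _×_; _,_)
open import Data.Sum using (_⊎_)
open import Relation.Nullary using (¬_)
open import Relation.Binary.PropositionalEquality using (_≡_; _≢_)
open import Relation.Unary using (Pred; _∈_; _∉_; _⊆_; _∪_; ∅; ｛_｝)

Subset : Set → Set₁
Subset E = Pred E 0ℓ

Maximal : {E : Set} → (Subset E → Set) → Subset E → Set₁
Maximal P I = P I × (∀ J → P J → I ⊆ J → J ⊆ I)

-- Matroids in the sense of Bruhn–Diestel–Kriesell–Pendavingh–Wollan,
-- via the independence axioms (I1), (I2), (I3), (IM).

record Matroid (E : Set) : Set₁ where
  field
    Indep : Subset E → Set
    I1 : Indep ∅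
    I2 : ∀ {I J} → J ⊆ I → Indep I → Indep J
    I3 : ∀ {I I'} → Indep I → ¬ Maximal Indep I → Maximal Indep I' →
         ∃[ x ] (x ∈ I' × x ∉ I × Indep (I ∪ ｛ x ｝))
    IM : ∀ {I X} → Indep I → I ⊆ X →
         ∃[ J ] Maximal (λ K → Indep K × I ⊆ K × K ⊆ X) J

open Matroid public

CircuitOf : {E : Set} → (Subset E → Set) → Subset E → Set₁
CircuitOf Ind C = ¬ Ind C × (∀ D → D ⊆ C → ¬ Ind D → C ⊆ D)

module _ {E : Set} (M : Matroid E) where

  Base : Subset E → Set₁
  Base B = Maximal (Indep M) B

  DualIndep : Subset E → Set₁
  DualIndep I = ∃[ B ] (Base B × (∀ e → e ∈ I → e ∉ B))

  Circuit : Subset E → Set₁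
  Circuit = CircuitOf (Indep M)

  Cocircuit : Subset E → Set₁
  Cocircuit C = ¬ DualIndep C × (∀ D → D ⊆ C → ¬ DualIndep D → C ⊆ D)

-- A signed subset X of E is encoded as a function
-- E → {0,+,-}: the support is {e | X e ≢ 0}, X⁺ = {e | X e ≡ +},
-- X⁻ = {e | X e ≡ -}; this is exactly a support with a partition (X⁺,X⁻).

data Sign : Set where
  𝟘 ⊕ ⊖ : Sign

SignedSubset : Set → Set
SignedSubset E = E → Sign

negS : Sign → Sign
negS 𝟘 = 𝟘
negS ⊕ = ⊖
negS ⊖ = ⊕

-- product of signs (used only on elements of the supports)
_·_ : Sign → Sign → Sign
𝟘 · _ = 𝟘
⊕ · s = s
⊖ · s = negS s

module _ {E : Set} where

  Positive Negative Support : SignedSubset E → Subset E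
  Positive X e = X e ≡ ⊕
  Negative X e = X e ≡ ⊖
  Support X e = X e ≢ 𝟘

  neg : SignedSubset E → SignedSubset E
  neg X e = negS (X e)

  _≈S_ : SignedSubset E → SignedSubset E → Set
  X ≈S Y = ∀ e → X e ≡ Y e

  SupportedBy : SignedSubset E → Subset E → Set
  SupportedBy X C = Support X ⊆ C × C ⊆ Support X

  Orthogonal : SignedSubset E → SignedSubset E → Set
  Orthogonal X Y =
    (∀ e → e ∈ Support X → e ∈ Support Y → ⊥)
    ⊎ (∃[ e ] ∃[ f ] (e ∈ Support X × e ∈ Support Y ×
                      f ∈ Support X × f ∈ Support Y ×
                      (X e · Y e) ≡ negS (X f · Y f)))

  SignedFamily : Set₁
  SignedFamily = SignedSubset E → Set

  SameFamily : SignedFamily → SignedFamily → Set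
  SameFamily 𝒜 ℬ =
    (∀ X → 𝒜 X → ∃[ Y ] (ℬ Y × X ≈S Y)) ×
    (∀ Y → ℬ Y → ∃[ X ] (𝒜 X × X ≈S Y))

  IsSignatureOf : ∀ {ℓ} → (Subset E → Set ℓ) → SignedFamily → Set (lsuc 0ℓ ⊔ ℓ)
  IsSignatureOf Circ 𝒮 =
    (∀ X → 𝒮 X → ∃[ C ] (Circ C × SupportedBy X C)) ×
    (∀ C → Circ C → ∃[ X ] (𝒮 X × 𝒮 (neg X) × SupportedBy X C ×
        (∀ Y → 𝒮 Y → SupportedBy Y C → (Y ≈S X) ⊎ (Y ≈S neg X))))

module _ {E : Set} (M : Matroid E) where

  CircuitSignature : SignedFamily {E} → Set₁
  CircuitSignature = IsSignatureOf (Circuit M)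

  CocircuitSignature : SignedFamily {E} → Set₁
  CocircuitSignature = IsSignatureOf (Cocircuit M)

  OrthogonallyOriented : SignedFamily {E} → SignedFamily {E} → Set₁
  OrthogonallyOriented 𝒞 𝒞* =
    CircuitSignature 𝒞 × CocircuitSignature 𝒞* ×
    (∀ X Y → 𝒞 X → 𝒞* Y → Orthogonal X Y)

-- If two signings Y, Ỹ of the same cocircuit D are both orthogonal to 𝒞 but
-- Ỹ ≠ ±Y, pick e ∈ D where they disagree and f ∈ D where they agree. The
-- fundamental circuit of f with respect to a base B with B ∩ D = {e} is a
-- circuit C with C ∩ D = {e, f}, so orthogonality of its signing X to Y and
-- to Ỹ reads X(e)Y(e) = -X(f)Y(f) and -X(e)Y(e) = -X(f)Y(f), which is absurd.
-- Hence the signings of each cocircuit are determined up to sign by 𝒞.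
module Submission where

open import Defs
open import Level using (0ℓ) renaming (suc to lsuc)
open import Axiom.ExcludedMiddle using (ExcludedMiddle)
open import Axiom.DoubleNegationElimination using (DoubleNegationElimination; em⇒dne)
open import Data.Empty using (⊥; ⊥-elim)
open import Data.Product using (∃-syntax; ∃₂; _×_; _,_; proj₁; proj₂)
open import Data.Sum using (_⊎_; inj₁; inj₂)
open import Relation.Nullary using (¬_; yes; no)
open import Relation.Binary.PropositionalEquality
  using (_≡_; _≢_; refl; sym; trans; cong; subst; module ≡-Reasoning)
open import Relation.Unary using (_∈_; _∉_; _⊆_; _∪_; _∩_; _∖_; ｛_｝)

negS-involutive : ∀ s → negS (negS s) ≡ s
negS-involutive 𝟘 = refl
negS-involutive ⊕ = refl
negS-involutive ⊖ = refl

≡negS-sym : ∀ {s t} → s ≡ negS t → t ≡ negS s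
≡negS-sym {t = t} eq = trans (sym (negS-involutive t)) (cong negS (sym eq))

≢negS-self : ∀ {s} → s ≢ 𝟘 → s ≢ negS s
≢negS-self {𝟘} s≢𝟘 _ = s≢𝟘 refl
≢negS-self {⊕} _ ()
≢negS-self {⊖} _ ()

·-nonzero : ∀ {s t} → s ≢ 𝟘 → t ≢ 𝟘 → s · t ≢ 𝟘
·-nonzero {𝟘} s≢𝟘 _ = s≢𝟘
·-nonzero {⊕} _ t≢𝟘 = t≢𝟘
·-nonzero {⊖} {𝟘} _ t≢𝟘 = t≢𝟘
·-nonzero {⊖} {⊕} _ _ ()
·-nonzero {⊖} {⊖} _ _ ()

·-negʳ : ∀ s t → s · negS t ≡ negS (s · t)
·-negʳ 𝟘 t = refl
·-negʳ ⊕ t = refl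
·-negʳ ⊖ t = refl

≢⇒≡negS : ∀ {s t} → s ≢ 𝟘 → t ≢ 𝟘 → s ≢ t → s ≡ negS t
≢⇒≡negS {𝟘} s≢𝟘 _ _ = ⊥-elim (s≢𝟘 refl)
≢⇒≡negS {_} {𝟘} _ t≢𝟘 _ = ⊥-elim (t≢𝟘 refl)
≢⇒≡negS {⊕} {⊕} _ _ s≢t = ⊥-elim (s≢t refl)
≢⇒≡negS {⊕} {⊖} _ _ _ = refl
≢⇒≡negS {⊖} {⊕} _ _ _ = refl
≢⇒≡negS {⊖} {⊖} _ _ s≢t = ⊥-elim (s≢t refl)

≢negS⇒≡ : ∀ {s t} → s ≢ 𝟘 → t ≢ 𝟘 → s ≢ negS t → s ≡ t
≢negS⇒≡ {𝟘} s≢𝟘 _ _ = ⊥-elim (s≢𝟘 refl)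
≢negS⇒≡ {_} {𝟘} _ t≢𝟘 _ = ⊥-elim (t≢𝟘 refl)
≢negS⇒≡ {⊕} {⊕} _ _ _ = refl
≢negS⇒≡ {⊕} {⊖} _ _ s≢-t = ⊥-elim (s≢-t refl)
≢negS⇒≡ {⊖} {⊕} _ _ s≢-t = ⊥-elim (s≢-t refl)
≢negS⇒≡ {⊖} {⊖} _ _ _ = refl

module _ {E : Set} where

  infixl 6 _-_ _+_

  _-_ : Subset E → E → Subset E
  A - x = A ∖ ｛ x ｝

  _+_ : Subset E → E → Subset E
  A + x = A ∪ ｛ x ｝

  +-⊆ : ∀ {A C : Subset E} {x} → A ⊆ C → x ∈ C → A + x ⊆ C
  +-⊆ A⊆C _ (inj₁ a∈A) = A⊆C a∈A
  +-⊆ {C = C} _ x∈C (inj₂ x≡z) = subst (_∈ C) x≡z x∈C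

  antisymmetric-on-pair : ∀ (g : E → Sign) {e f a b} → g e ≢ 𝟘 → g f ≢ 𝟘 →
    a ∈ ｛ e ｝ ∪ ｛ f ｝ → b ∈ ｛ e ｝ ∪ ｛ f ｝ → g a ≡ negS (g b) → g e ≡ negS (g f)
  antisymmetric-on-pair g ge≢𝟘 _ (inj₁ refl) (inj₁ refl) eq = ⊥-elim (≢negS-self ge≢𝟘 eq)
  antisymmetric-on-pair g _ _ (inj₁ refl) (inj₂ refl) eq = eq
  antisymmetric-on-pair g _ _ (inj₂ refl) (inj₁ refl) eq = ≡negS-sym eq
  antisymmetric-on-pair g _ gf≢𝟘 (inj₂ refl) (inj₂ refl) eq = ⊥-elim (≢negS-self gf≢𝟘 eq)

  orthogonal-on-pair : ∀ {X Z : SignedSubset E} {e f} →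
    Support X ∩ Support Z ⊆ ｛ e ｝ ∪ ｛ f ｝ →
    e ∈ Support X ∩ Support Z → f ∈ Support X ∩ Support Z →
    Orthogonal X Z → X e · Z e ≡ negS (X f · Z f)
  orthogonal-on-pair _ (eX , eZ) _ (inj₁ disjoint) = ⊥-elim (disjoint _ eX eZ)
  orthogonal-on-pair {X} {Z} meet (eX , eZ) (fX , fZ) (inj₂ (a , b , aX , aZ , bX , bZ , eq)) =
    antisymmetric-on-pair (λ y → X y · Z y) (·-nonzero eX eZ) (·-nonzero fX fZ)
      (meet (aX , aZ)) (meet (bX , bZ)) eq

module Classical (em : ExcludedMiddle 0ℓ) (em₁ : ExcludedMiddle (lsuc 0ℓ)) {E : Set} where

  dne : DoubleNegationElimination 0ℓ
  dne = em⇒dne em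

  dne₁ : DoubleNegationElimination (lsuc 0ℓ)
  dne₁ = em⇒dne em₁

  counterexample : ∀ {P : E → Set} → ¬ (∀ x → P x) → ∃[ x ] ¬ P x
  counterexample ¬∀ = dne λ ¬∃ → ¬∀ λ x → dne λ ¬Px → ¬∃ (x , ¬Px)

  vanishes-outside : ∀ {Y : SignedSubset E} {D e} → SupportedBy Y D → e ∉ D → Y e ≡ 𝟘
  vanishes-outside (Y⊆D , _) e∉D = dne λ Ye≢𝟘 → e∉D (Y⊆D Ye≢𝟘)

  ≈S-or-neg-or-mixed : ∀ {Y Ỹ : SignedSubset E} {D} → SupportedBy Y D → SupportedBy Ỹ D →
    Ỹ ≈S Y ⊎ Ỹ ≈S neg Y ⊎
    ∃₂ λ e f → e ∈ D × f ∈ D × Ỹ e ≡ negS (Y e) × Ỹ f ≡ Y f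
  ≈S-or-neg-or-mixed {Y} {Ỹ} {D} sY sỸ with em {Ỹ ≈S Y} | em {Ỹ ≈S neg Y}
  ... | yes Ỹ≈Y | _ = inj₁ Ỹ≈Y
  ... | no _ | yes Ỹ≈-Y = inj₂ (inj₁ Ỹ≈-Y)
  ... | no Ỹ≉Y | no Ỹ≉-Y with counterexample Ỹ≉Y | counterexample Ỹ≉-Y
  ... | e , Ỹe≢Ye | f , Ỹf≢-Yf =
    inj₂ (inj₂ (e , f , e∈D , f∈D ,
      ≢⇒≡negS (proj₂ sỸ e∈D) (proj₂ sY e∈D) Ỹe≢Ye ,
      ≢negS⇒≡ (proj₂ sỸ f∈D) (proj₂ sY f∈D) Ỹf≢-Yf))
    where
    e∈D : e ∈ D
    e∈D = dne λ e∉D → Ỹe≢Ye (trans (vanishes-outside sỸ e∉D) (sym (vanishes-outside sY e∉D)))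
    f∈D : f ∈ D
    f∈D = dne λ f∉D → Ỹf≢-Yf
      (trans (vanishes-outside sỸ f∉D) (sym (cong negS (vanishes-outside sY f∉D))))

  module _ (M : Matroid E) where

    +-dependent : ∀ {B x} → Base M B → x ∉ B → ¬ Indep M (B + x)
    +-dependent (_ , maxB) x∉B indep = x∉B (maxB _ indep inj₁ (inj₂ refl))

    deletion-not-maximal : ∀ {B x} → Indep M B → x ∈ B → ¬ Maximal (Indep M) (B - x)
    deletion-not-maximal indB x∈B (_ , max) = proj₂ (max _ indB proj₁ x∈B) refl

    exchange-base : ∀ {B e x} → Base M B → x ∉ B → Indep M (B - e + x) → Base M (B - e + x)
    exchange-base {B} {e} {x} base x∉B indep = dne₁ λ notBase →
      let (y , y∈B , y∉B-e+x , indep′) = I3 M indep notBase base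
          e≡y : e ≡ y
          e≡y = dne λ e≢y → y∉B-e+x (inj₁ (y∈B , e≢y))
      in +-dependent base x∉B (I2 M (B+x⊆ e≡y) indep′)
      where
      B+x⊆ : ∀ {y} → e ≡ y → B + x ⊆ B - e + x + y
      B+x⊆ {y} e≡y {z} (inj₁ z∈B) with em {e ≡ z}
      ... | yes e≡z = inj₂ (trans (sym e≡y) e≡z)
      ... | no e≢z = inj₁ (inj₁ (z∈B , e≢z))
      B+x⊆ _ (inj₂ x≡z) = inj₁ (inj₂ x≡z)

    maximal-independent-base : ∀ {A B C J} → Base M B → B ⊆ A →
      Maximal (λ K → Indep M K × C ⊆ K × K ⊆ A) J → Base M J
    maximal-independent-base base B⊆A ((indJ , C⊆J , J⊆A) , maxJ) = dne₁ λ notBase →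
      let (z , z∈B , z∉J , indep) = I3 M indJ notBase base
      in z∉J (maxJ _ (indep , (λ c → inj₁ (C⊆J c)) , +-⊆ J⊆A (B⊆A z∈B)) inj₁ (inj₂ refl))

    circuit-from-deletions : ∀ {C} → ¬ Indep M C → (∀ {y} → y ∈ C → Indep M (C - y)) →
      Circuit M C
    circuit-from-deletions dep indep-deletion = dep , λ D D⊆C depD {y} y∈C → dne λ y∉D →
      depD (I2 M (λ z∈D → D⊆C z∈D , λ y≡z → y∉D (subst (_∈ D) (sym y≡z) z∈D))
                 (indep-deletion y∈C))

    fundamentalCircuit : Subset E → E → Subset E
    fundamentalCircuit B f = ｛ f ｝ ∪ (λ z → z ∈ B × Indep M (B - z + f))

    fundamentalCircuit-⊆ : ∀ {B f} → fundamentalCircuit B f ⊆ B + f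
    fundamentalCircuit-⊆ (inj₁ f≡z) = inj₂ f≡z
    fundamentalCircuit-⊆ (inj₂ (z∈B , _)) = inj₁ z∈B

    fundamentalCircuit-deletion : ∀ {B f y} → Indep M B → y ∈ fundamentalCircuit B f →
      Indep M (fundamentalCircuit B f - y)
    fundamentalCircuit-deletion indB (inj₁ f≡y) = I2 M
      (λ { (inj₁ f≡z , y≢z) → ⊥-elim (y≢z (trans (sym f≡y) f≡z))
         ; (inj₂ (z∈B , _) , _) → z∈B })
      indB
    fundamentalCircuit-deletion _ (inj₂ (_ , indep)) = I2 M
      (λ { (inj₁ f≡z , _) → inj₂ f≡z
         ; (inj₂ (z∈B , _) , y≢z) → inj₁ (z∈B , y≢z) })
      indep

    -- Extend the circuit to a maximal independent J ⊆ B + f, which is a base; an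
    -- element y ∈ B missing from J exchanges against f ∈ J, putting y into the circuit.
    fundamentalCircuit-dependent : ∀ {B f} → Base M B → f ∉ B →
      ¬ Indep M (fundamentalCircuit B f)
    fundamentalCircuit-dependent {B} {f} base f∉B indC
      with IM M indC fundamentalCircuit-⊆
    ... | J , maximal@((_ , C⊆J , J⊆B+f) , _) = outside-J missing
      where
      baseJ : Base M J
      baseJ = maximal-independent-base base inj₁ maximal

      missing : ∃[ y ] (y ∈ B + f × y ∉ J)
      missing = dne λ ¬missing → +-dependent base f∉B
        (I2 M (λ {y} y∈B+f → dne λ y∉J → ¬missing (y , y∈B+f , y∉J)) (proj₁ baseJ))

      outside-J : ∃[ y ] (y ∈ B + f × y ∉ J) → ⊥
      outside-J (y , inj₂ f≡y , y∉J) = y∉J (C⊆J (inj₁ f≡y))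
      outside-J (y , inj₁ y∈B , y∉J)
        with I3 M (I2 M proj₁ (proj₁ base)) (deletion-not-maximal (proj₁ base) y∈B) baseJ
      ... | w , w∈J , w∉B-y , indep =
        y∉J (C⊆J (inj₂ (y∈B , subst (λ v → Indep M (B - y + v)) w≡f indep)))
        where
        w≡f : w ≡ f
        w≡f with J⊆B+f w∈J
        ... | inj₂ f≡w = sym f≡w
        ... | inj₁ w∈B = ⊥-elim (y∉J (subst (_∈ J) (sym y≡w) w∈J))
          where
          y≡w : y ≡ w
          y≡w = dne λ y≢w → w∉B-y (w∈B , y≢w)

    fundamentalCircuit-circuit : ∀ {B f} → Base M B → f ∉ B →
      Circuit M (fundamentalCircuit B f)
    fundamentalCircuit-circuit base f∉B = circuit-from-deletions
      (fundamentalCircuit-dependent base f∉B) (fundamentalCircuit-deletion (proj₁ base))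

    cocircuit-base : ∀ {D e} → Cocircuit M D → e ∈ D →
      ∃[ B ] (Base M B × B ∩ D ⊆ ｛ e ｝ × e ∈ B)
    cocircuit-base {D} {e} (codep , minD) e∈D
      with dne₁ {DualIndep M (D - e)} (λ codep′ → proj₂ (minD (D - e) proj₁ codep′ e∈D) refl)
    ... | B , base , B-avoids-D-e = B , base , B∩D⊆e , e∈B
      where
      B∩D⊆e : B ∩ D ⊆ ｛ e ｝
      B∩D⊆e {z} (z∈B , z∈D) = dne λ e≢z → B-avoids-D-e z (z∈D , e≢z) z∈B

      e∈B : e ∈ B
      e∈B = dne λ e∉B → codep
        (B , base , λ z z∈D z∈B → e∉B (subst (_∈ B) (sym (B∩D⊆e (z∈B , z∈D))) z∈B))

    -- The element entering B - e from a base meeting D only in f must be f itself,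
    -- since otherwise the resulting base would avoid the cocircuit D.
    cocircuit-exchange : ∀ {D B e f} → Cocircuit M D → Base M B → B ∩ D ⊆ ｛ e ｝ →
      e ∈ B → e ∈ D → f ∈ D → e ≢ f → Indep M (B - e + f)
    cocircuit-exchange {D} {B} {e} {f} cocD@(codep , _) base B∩D⊆e e∈B e∈D f∈D e≢f
      with cocircuit-base cocD f∈D
    ... | B′ , base′ , B′∩D⊆f , _
      with I3 M (I2 M proj₁ (proj₁ base)) (deletion-not-maximal (proj₁ base) e∈B) base′
    ... | x , x∈B′ , x∉B-e , indep = subst (λ v → Indep M (B - e + v)) x≡f indep
      where
      x∉B : x ∉ B
      x∉B x∈B = x∉B-e (x∈B , λ e≡x → e≢f (sym (B′∩D⊆f (subst (_∈ B′) (sym e≡x) x∈B′ , e∈D))))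

      x≡f : x ≡ f
      x≡f = dne λ x≢f → codep (_ , exchange-base base x∉B indep , λ where
        z z∈D (inj₁ (z∈B , e≢z)) → e≢z (B∩D⊆e (z∈B , z∈D))
        z z∈D (inj₂ x≡z) → x≢f (sym (B′∩D⊆f (x∈B′ , subst (_∈ D) (sym x≡z) z∈D))))

    cocircuit-circuit-pair : ∀ {D e f} → Cocircuit M D → e ∈ D → f ∈ D → e ≢ f →
      ∃[ C ] (Circuit M C × e ∈ C × f ∈ C × C ∩ D ⊆ ｛ e ｝ ∪ ｛ f ｝)
    cocircuit-circuit-pair {D} {e} {f} cocD e∈D f∈D e≢f with cocircuit-base cocD e∈D
    ... | B , base , B∩D⊆e , e∈B =
      fundamentalCircuit B f ,
      fundamentalCircuit-circuit base f∉B ,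
      inj₂ (e∈B , cocircuit-exchange cocD base B∩D⊆e e∈B e∈D f∈D e≢f) ,
      inj₁ refl ,
      C∩D⊆
      where
      f∉B : f ∉ B
      f∉B f∈B = e≢f (B∩D⊆e (f∈B , f∈D))

      C∩D⊆ : fundamentalCircuit B f ∩ D ⊆ ｛ e ｝ ∪ ｛ f ｝
      C∩D⊆ (inj₁ f≡z , _) = inj₂ f≡z
      C∩D⊆ (inj₂ (z∈B , _) , z∈D) = inj₁ (B∩D⊆e (z∈B , z∈D))

    cocircuit-signing-unique : ∀ {𝒞 D} {Y Ỹ : SignedSubset E} →
      CircuitSignature M 𝒞 → Cocircuit M D → SupportedBy Y D → SupportedBy Ỹ D →
      (∀ X → 𝒞 X → Orthogonal X Y) → (∀ X → 𝒞 X → Orthogonal X Ỹ) →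
      Ỹ ≈S Y ⊎ Ỹ ≈S neg Y
    cocircuit-signing-unique {D = D} {Y} {Ỹ} (_ , signs) cocD sY sỸ X⊥Y X⊥Ỹ
      with ≈S-or-neg-or-mixed sY sỸ
    ... | inj₁ Ỹ≈Y = inj₁ Ỹ≈Y
    ... | inj₂ (inj₁ Ỹ≈-Y) = inj₂ Ỹ≈-Y
    ... | inj₂ (inj₂ (e , f , e∈D , f∈D , Ỹe , Ỹf))
      with cocircuit-circuit-pair cocD e∈D f∈D e≢f
      where
      e≢f : e ≢ f
      e≢f refl = ≢negS-self (proj₂ sY e∈D) (trans (sym Ỹf) Ỹe)
    ... | C , circuitC , e∈C , f∈C , C∩D⊆
      with signs C circuitC
    ... | X , X∈𝒞 , _ , sX , _ =
      ⊥-elim (≢negS-self (·-nonzero (proj₂ sX e∈C) (proj₂ sY e∈D)) XeYe≡-XeYe)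
      where
      open ≡-Reasoning

      pair : ∀ {Z} → SupportedBy Z D → Orthogonal X Z → X e · Z e ≡ negS (X f · Z f)
      pair sZ = orthogonal-on-pair
        (λ (x∈X , x∈Z) → C∩D⊆ (proj₁ sX x∈X , proj₁ sZ x∈Z))
        (proj₂ sX e∈C , proj₂ sZ e∈D) (proj₂ sX f∈C , proj₂ sZ f∈D)

      XeYe≡-XeYe : X e · Y e ≡ negS (X e · Y e)
      XeYe≡-XeYe = begin
        X e · Y e          ≡⟨ pair sY (X⊥Y X X∈𝒞) ⟩
        negS (X f · Y f)   ≡⟨ cong (λ s → negS (X f · s)) (sym Ỹf) ⟩
        negS (X f · Ỹ f)   ≡⟨ sym (pair sỸ (X⊥Ỹ X X∈𝒞)) ⟩
        X e · Ỹ e          ≡⟨ cong (X e ·_) Ỹe ⟩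
        X e · negS (Y e)   ≡⟨ ·-negʳ (X e) (Y e) ⟩
        negS (X e · Y e)   ∎

    signature-refines : ∀ {𝒞 𝒜 ℬ} → CircuitSignature M 𝒞 →
      CocircuitSignature M 𝒜 → CocircuitSignature M ℬ →
      (∀ X Y → 𝒞 X → 𝒜 Y → Orthogonal X Y) → (∀ X Y → 𝒞 X → ℬ Y → Orthogonal X Y) →
      ∀ Y → 𝒜 Y → ∃[ Z ] (ℬ Z × Y ≈S Z)
    signature-refines sig𝒞 (𝒜-supported , _) (_ , ℬ-signs) 𝒞⊥𝒜 𝒞⊥ℬ Y Y∈𝒜
      with 𝒜-supported Y Y∈𝒜
    ... | D , cocD , sY with ℬ-signs D cocD
    ... | Z , Z∈ℬ , -Z∈ℬ , sZ , _
      with cocircuit-signing-unique sig𝒞 cocD sZ sY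
             (λ X X∈𝒞 → 𝒞⊥ℬ X Z X∈𝒞 Z∈ℬ) (λ X X∈𝒞 → 𝒞⊥𝒜 X Y X∈𝒞 Y∈𝒜)
    ... | inj₁ Y≈Z = Z , Z∈ℬ , Y≈Z
    ... | inj₂ Y≈-Z = neg Z , -Z∈ℬ , Y≈-Z

proposition3p8 : ExcludedMiddle 0ℓ → ExcludedMiddle (lsuc 0ℓ) →
    {E : Set} (M : Matroid E) (𝒞 𝒞* 𝒞̃* : SignedFamily {E}) →
    OrthogonallyOriented M 𝒞 𝒞* →
    CocircuitSignature M 𝒞̃* →
    (∀ X Y → 𝒞 X → 𝒞̃* Y → Orthogonal X Y) →
    SameFamily 𝒞̃* 𝒞*
proposition3p8 em em₁ M 𝒞 𝒞* 𝒞̃* (sig𝒞 , sig𝒞* , 𝒞⊥𝒞*) sig𝒞̃* 𝒞⊥𝒞̃* =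
  signature-refines M sig𝒞 sig𝒞̃* sig𝒞* 𝒞⊥𝒞̃* 𝒞⊥𝒞* ,
  λ Y Y∈𝒞* →
    let (Z , Z∈𝒞̃* , Y≈Z) = signature-refines M sig𝒞 sig𝒞* sig𝒞̃* 𝒞⊥𝒞* 𝒞⊥𝒞̃* Y Y∈𝒞*
    in Z , Z∈𝒞̃* , λ e → sym (Y≈Z e)
  where open Classical em em₁
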